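{- Let $k,l\ge 1$. Let $L_{2k+1}^*$ be the digraph with vertices $u_i,v_i$ ($0\le i\le 2k$) and arcs $(u_i,u_{i+1})$ and $(v_i,v_{i+1})$ for $0\le i\le 2k-1$, and $(v_i,u_i)$ for $0\le i\le 2k$ (the ladder with $2k+1$ rungs oriented left-to-right and bottom-to-top). Then there exists a $((6k+1)l^2+1,\,4k+2,\,l,\,1;\,L_{2k+1}^*)$-EDF in $\mathbb{Z}_{(6k+1)l^2+1}$.
   Context: $\Delta(A,B)=\{a-b:a\in A,b\in B\}$ (multiset). For a group $\Gamma$ of order $N$ and a digraph $H$ with $m$ vertices, a family $(A_v)_{v\in V(H)}$ of pairwise disjoint $l$-subsets of $\Gamma$ is an $(N,m,l,\lambda;H)$-EDF if $\bigcup_{(u,v)\in\overrightarrow{E}(H)}\Delta(A_v,A_u)=\lambda(\Gamma\setminus\{0\})$ as multisets. -}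

module Defs where

open import Data.Nat using (ℕ; zero; suc; _+_; _*_; _∸_; NonZero)
open import Data.Nat.DivMod using (_%_)
open import Data.Fin using (Fin; toℕ; fromℕ<; _↑ˡ_; _↑ʳ_)
open import Data.Fin.Properties using ()
open import Data.Nat.DivMod using (m%n<n)
open import Data.List using (List; []; _∷_; length; map; concatMap; concat; allFin; filter; upTo; _++_)
open import Data.List.Relation.Unary.Unique.Propositional using (Unique)
open import Data.List.Membership.Propositional using (_∈_)
open import Data.List.Relation.Binary.Permutation.Propositional using (_↭_)
open import Data.Product using (_×_; _,_; proj₁; proj₂)
open import Relation.Nullary using (¬_)
open import Relation.Binary.PropositionalEquality using (_≡_)
open import Data.Fin using (_≟_)
open import Relation.Nullary.Decidable using (¬?)

_-ℤ_ : ∀ {N} .{{_ : NonZero N}} → Fin N → Fin N → Fin N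
_-ℤ_ {N} a b = fromℕ< (m%n<n (toℕ a + N ∸ toℕ b) N)

record Digraph (m : ℕ) : Set where
  constructor mkDigraph
  field
    arcs : List (Fin m × Fin m)

Δ : ∀ {N} .{{_ : NonZero N}} → List (Fin N) → List (Fin N) → List (Fin N)
Δ A B = concatMap (λ a → map (λ b → a -ℤ b) B) A

replicateL : {A : Set} → ℕ → List A → List A
replicateL zero xs = []
replicateL (suc n) xs = xs ++ replicateL n xs

nonzeroElems : (N : ℕ) → List (Fin N)
nonzeroElems zero = []
nonzeroElems (suc N) = map Data.Fin.suc (allFin N)

-- (N, m, l, λ; H)-EDF in Z_N: a family (A_v) of pairwise disjoint l-subsets
-- of Z_N (subsets represented as duplicate-free lists), such that the multiset
-- union over arcs (u,v) of Δ(A_v, A_u) equals λ(Z_N \ {0}).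
record IsEDF (N m l λ' : ℕ) .{{_ : NonZero N}} (H : Digraph m)
             (A : Fin m → List (Fin N)) : Set where
  field
    size     : ∀ v → length (A v) ≡ l
    isSet    : ∀ v → Unique (A v)
    disjoint : ∀ u v → ¬ (u ≡ v) → ∀ x → x ∈ A u → ¬ (x ∈ A v)
    differences :
      concatMap (λ e → Δ (A (proj₂ e)) (A (proj₁ e))) (Digraph.arcs H)
        ↭ replicateL λ' (nonzeroElems N)

ladderArcs : (n : ℕ) → List (Fin (n + n) × Fin (n + n))
ladderArcs n = rails ++ map (λ i → (v i , u i)) (allFin n)
  where
    u : Fin n → Fin (n + n)
    u i = i ↑ˡ n
    v : Fin n → Fin (n + n)
    v i = n ↑ʳ i
    rails : List (Fin (n + n) × Fin (n + n))
    rails = concatMap step (allFin n)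
      where
        open import Data.Nat using (_<?_)
        open import Relation.Nullary using (yes; no)
        open import Data.Nat.Properties using ()
        step : Fin n → List (Fin (n + n) × Fin (n + n))
        step i with suc (toℕ i) <? n
        ... | yes p = (u i , u (fromℕ< p)) ∷ (v i , v (fromℕ< p)) ∷ []
        ... | no _  = []

L* : (n : ℕ) → Digraph (n + n)
L* n = mkDigraph (ladderArcs n)

-- Put L = l², M = 6k + 1 and N = ML + 1, and cut the nonzero residues into the M runs
-- J t = {tL + 1, …, tL + L}.  Use two kinds of l-sets: intervals I α = {αL + i : i < l} and
-- progressions P β = {βL + l(j + 1) : j < l}.  As i, j range below l, the numbers l(j + 1) − i
-- hit 1, …, L exactly once, so Δ(P β, I α) = J (β − α) for α ≤ β and, wrapping around,
-- Δ(I α, P β) = J (α + M − 1 − β).  On rung m of the ladder put the interval of index ⌊3m/2⌋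
-- and the progression of index 6k − ⌈3m/2⌉, alternating sides, so that every arc joins an
-- interval to a progression.  The 6k + 1 arcs then receive the run indices 0, …, 6k once each:
-- the odd ones increase along the ladder, the even ones decrease.  All intervals lie at or
-- below block 3k and all progressions at or above it, which makes the sets pairwise disjoint.
module Submission where

import Algebra.Properties.CommutativeSemigroup
open import Data.Empty using (⊥; ⊥-elim)
open import Data.Fin as Fin using (Fin; toℕ; fromℕ<; _↑ˡ_; _↑ʳ_; splitAt; join)
open import Data.Fin.Properties
  using (toℕ-fromℕ<; fromℕ<-cong; toℕ-injective; toℕ<n; splitAt-↑ˡ; splitAt-↑ʳ; join-splitAt)
open import Data.List
  using (List; []; _∷_; _++_; _∷ʳ_; [_]; upTo; map; concat; concatMap; applyUpTo; applyDownFrom; allFin;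
         tabulate; reverse; length)
open import Data.List.Effectful using (module MonadProperties)
open import Data.List.Membership.Propositional using (_∈_)
open import Data.List.Membership.Propositional.Properties using (∈-map⁻; ∈-applyUpTo⁻)
open import Data.List.Properties
  using (map-applyUpTo; map-upTo; concatMap-++; concatMap-map; reverse-applyUpTo; concat-map-[_]; ++-assoc;
         ++-identityʳ; map-∘; map-tabulate; length-map; length-applyUpTo)
open import Data.List.Relation.Binary.BagAndSetEquality using (↭⇒∼bag; ∼bag⇒↭; concat-cong)
open import Data.List.Relation.Binary.Permutation.Propositional
  using (_↭_; ↭-refl; ↭-trans; ↭-reflexive; ↭-prep; ↭-swap; module PermutationReasoning)
open import Data.List.Relation.Binary.Permutation.Propositional.Properties
  using (++⁺; ++⁺ˡ; shifts; ↭-reverse; ∷↭∷ʳ; map⁺) renaming (shift to ↭-shift)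
open import Data.List.Relation.Binary.Pointwise using (Pointwise-≡⇒≡; []; _∷_)
open import Data.List.Relation.Unary.Unique.Propositional using (Unique)
open import Data.List.Relation.Unary.Unique.Propositional.Properties using (applyUpTo⁺₁)
open import Data.Nat
  using (ℕ; zero; suc; _+_; _*_; _∸_; _<_; _≤_; _≥_; z≤n; s≤s; z<s; s<s; NonZero; >-nonZero; _<?_)
open import Data.Nat.DivMod using (m%n<n; m<n⇒m%n≡m; [m+n]%n≡m%n)
open import Data.Nat.Properties
open import Data.Nat.Tactic.RingSolver using (solve-∀)
open import Data.Product using (Σ; ∃-syntax; _×_; _,_; proj₁; proj₂; map₂; uncurry)
open import Data.Sum using (_⊎_; inj₁; inj₂; [_,_]′)
open import Data.Unit using (⊤; tt)
open import Function using (id; _∘_)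
open import Relation.Binary.Definitions using (tri<; tri≈; tri>)
open import Relation.Binary.PropositionalEquality hiding ([_])
open import Relation.Nullary using (¬_; yes; no)
open import Relation.Nullary.Decidable using (dec-yes-irr; dec-no)

open import Defs

open MonadProperties using (associative)
open Algebra.Properties.CommutativeSemigroup +-commutativeSemigroup using (x∙yz≈y∙xz)

private
  variable
    X : Set

applyUpTo-cong-< : ∀ n {f g : ℕ → X} → (∀ i → i < n → f i ≡ g i) → applyUpTo f n ≡ applyUpTo g n
applyUpTo-cong-< zero    f≡g = refl
applyUpTo-cong-< (suc n) f≡g = cong₂ _∷_ (f≡g 0 z<s) (applyUpTo-cong-< n λ i i<n → f≡g (suc i) (s<s i<n))

concat-applyUpTo⁺ : ∀ n {f g : ℕ → List X} → (∀ i → i < n → f i ↭ g i) →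
                    concat (applyUpTo f n) ↭ concat (applyUpTo g n)
concat-applyUpTo⁺ zero    f↭g = ↭-refl
concat-applyUpTo⁺ (suc n) f↭g = ++⁺ (f↭g 0 z<s) (concat-applyUpTo⁺ n λ i i<n → f↭g (suc i) (s<s i<n))

concat⁺ : {xss yss : List (List X)} → xss ↭ yss → concat xss ↭ concat yss
concat⁺ xss↭yss = ∼bag⇒↭ (concat-cong (↭⇒∼bag xss↭yss))

applyUpTo-+ : ∀ (f : ℕ → X) m n → applyUpTo f (m + n) ≡ applyUpTo f m ++ applyUpTo (λ i → f (m + i)) n
applyUpTo-+ f zero    n = refl
applyUpTo-+ f (suc m) n = cong (f 0 ∷_) (applyUpTo-+ (λ i → f (suc i)) m n)

applyUpTo-* : ∀ (f : ℕ → X) m n →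
              applyUpTo f (m * n) ≡ concat (applyUpTo (λ i → applyUpTo (λ c → f (c + i * n)) n) m)
applyUpTo-* f zero    n = refl
applyUpTo-* f (suc m) n = begin
  applyUpTo f (n + m * n)
    ≡⟨ applyUpTo-+ f n (m * n) ⟩
  applyUpTo f n ++ applyUpTo (λ i → f (n + i)) (m * n)
    ≡⟨ cong₂ _++_ (applyUpTo-cong-< n λ c _ → cong f (sym (+-identityʳ c)))
                  (applyUpTo-* (λ i → f (n + i)) m n) ⟩
  applyUpTo (λ c → f (c + 0)) n ++ concat (applyUpTo (λ i → applyUpTo (λ c → f (n + (c + i * n))) n) m)
    ≡⟨ cong (applyUpTo (λ c → f (c + 0)) n ++_) (cong concat (applyUpTo-cong-< m λ i _ →
         applyUpTo-cong-< n λ c _ → cong f (x∙yz≈y∙xz n c (i * n)))) ⟩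
  concat (applyUpTo (λ i → applyUpTo (λ c → f (c + i * n)) n) (suc m)) ∎
  where open ≡-Reasoning

applyUpTo-reverse : ∀ (f : ℕ → X) n → applyUpTo (λ i → f (n ∸ suc i)) n ↭ applyUpTo f n
applyUpTo-reverse f n = begin
  applyUpTo (λ i → f (n ∸ suc i)) n ≡⟨ applyDownFrom-applyUpTo n ⟨
  applyDownFrom f n                 ≡⟨ reverse-applyUpTo f n ⟨
  reverse (applyUpTo f n)           ↭⟨ ↭-reverse (applyUpTo f n) ⟩
  applyUpTo f n                     ∎
  where
  open PermutationReasoning
  applyDownFrom-applyUpTo : ∀ n → applyDownFrom f n ≡ applyUpTo (λ i → f (n ∸ suc i)) n
  applyDownFrom-applyUpTo zero    = refl
  applyDownFrom-applyUpTo (suc n) = cong (f n ∷_) (applyDownFrom-applyUpTo n)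

concat-applyUpTo-++ : ∀ {X : Set} (f g : ℕ → List X) n →
  concat (applyUpTo (λ i → f i ++ g i) n) ↭ concat (applyUpTo f n) ++ concat (applyUpTo g n)
concat-applyUpTo-++ f g zero    = ↭-refl
concat-applyUpTo-++ {X} f g (suc n) = begin
  (f 0 ++ g 0) ++ concat (applyUpTo (λ i → f (suc i) ++ g (suc i)) n)
    ↭⟨ ++⁺ˡ (f 0 ++ g 0) (concat-applyUpTo-++ (λ i → f (suc i)) (λ i → g (suc i)) n) ⟩
  (f 0 ++ g 0) ++ (F ++ G)  ≡⟨ ++-assoc (f 0) (g 0) (F ++ G) ⟩
  f 0 ++ (g 0 ++ (F ++ G))  ↭⟨ ++⁺ˡ (f 0) (shifts (g 0) F) ⟩
  f 0 ++ (F ++ (g 0 ++ G))  ≡⟨ ++-assoc (f 0) F (g 0 ++ G) ⟨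
  (f 0 ++ F) ++ (g 0 ++ G)  ∎
  where
  open PermutationReasoning
  F G : List X
  F = concat (applyUpTo (λ i → f (suc i)) n)
  G = concat (applyUpTo (λ i → g (suc i)) n)

concat-applyUpTo-[-] : ∀ (f : ℕ → X) n → concat (applyUpTo (λ i → [ f i ]) n) ≡ applyUpTo f n
concat-applyUpTo-[-] f n = trans (cong concat (sym (map-applyUpTo f [_] n))) (concat-map-[ applyUpTo f n ])

concat-applyUpTo-transpose : ∀ (f : ℕ → ℕ → X) a b →
  concat (applyUpTo (λ i → applyUpTo (f i) b) a) ↭ concat (applyUpTo (λ j → applyUpTo (λ i → f i j) a) b)
concat-applyUpTo-transpose f a zero    = ↭-reflexive (concat-applyUpTo-[] a)
  where
  concat-applyUpTo-[] : ∀ a → concat (applyUpTo (λ _ → []) a) ≡ ([] {A = X})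
  concat-applyUpTo-[] zero    = refl
  concat-applyUpTo-[] (suc a) = concat-applyUpTo-[] a
concat-applyUpTo-transpose f a (suc b) = begin
  concat (applyUpTo (λ i → [ f i 0 ] ++ applyUpTo (f i ∘ suc) b) a)
    ↭⟨ concat-applyUpTo-++ (λ i → [ f i 0 ]) (λ i → applyUpTo (f i ∘ suc) b) a ⟩
  concat (applyUpTo (λ i → [ f i 0 ]) a) ++ concat (applyUpTo (λ i → applyUpTo (f i ∘ suc) b) a)
    ≡⟨ cong (_++ concat (applyUpTo (λ i → applyUpTo (f i ∘ suc) b) a))
            (concat-applyUpTo-[-] (λ i → f i 0) a) ⟩
  applyUpTo (λ i → f i 0) a ++ concat (applyUpTo (λ i → applyUpTo (f i ∘ suc) b) a)
    ↭⟨ ++⁺ˡ _ (concat-applyUpTo-transpose (λ i j → f i (suc j)) a b) ⟩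
  applyUpTo (λ i → f i 0) a ++ concat (applyUpTo (λ j → applyUpTo (λ i → f i (suc j)) a) b) ∎
  where open PermutationReasoning

map-allFin : ∀ n {f : Fin n → X} {g : ℕ → X} → (∀ i → f i ≡ g (toℕ i)) →
             map f (allFin n) ≡ applyUpTo g n
map-allFin n {f} f≡g = trans (map-tabulate id f) (tabulate-applyUpTo n f≡g)
  where
  tabulate-applyUpTo : ∀ n {f : Fin n → X} {g : ℕ → X} → (∀ i → f i ≡ g (toℕ i)) →
                       tabulate f ≡ applyUpTo g n
  tabulate-applyUpTo zero    f≡g = refl
  tabulate-applyUpTo (suc n) f≡g = cong₂ _∷_ (f≡g Fin.zero) (tabulate-applyUpTo n (f≡g ∘ Fin.suc))

concat-applyUpTo-pairs : ∀ {X : Set} (f : ℕ → List X) k →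
  concat (applyUpTo f (suc (k * 2))) ≡ concat (applyUpTo (λ j → f (j * 2) ++ f (suc (j * 2))) k) ++ f (k * 2)
concat-applyUpTo-pairs f zero    = ++-identityʳ (f 0)
concat-applyUpTo-pairs {X} f (suc k) = begin
  f 0 ++ (f 1 ++ concat (applyUpTo (f ∘ suc ∘ suc) (suc (k * 2))))
    ≡⟨ ++-assoc (f 0) (f 1) _ ⟨
  (f 0 ++ f 1) ++ concat (applyUpTo (f ∘ suc ∘ suc) (suc (k * 2)))
    ≡⟨ cong ((f 0 ++ f 1) ++_) (concat-applyUpTo-pairs (f ∘ suc ∘ suc) k) ⟩
  (f 0 ++ f 1) ++ (pairs ++ f (suc k * 2))
    ≡⟨ ++-assoc (f 0 ++ f 1) pairs _ ⟨
  ((f 0 ++ f 1) ++ pairs) ++ f (suc k * 2) ∎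
  where
  open ≡-Reasoning
  pairs : List X
  pairs = concat (applyUpTo (λ j → f (suc (suc (j * 2))) ++ f (suc (suc (suc (j * 2))))) k)

concatMap⁺ : ∀ {B : Set} {f g : X → List B} xs → (∀ x → f x ↭ g x) → concatMap f xs ↭ concatMap g xs
concatMap⁺ []       f↭g = ↭-refl
concatMap⁺ (x ∷ xs) f↭g = ++⁺ (f↭g x) (concatMap⁺ xs f↭g)

module Residues (n : ℕ) where

  N : ℕ
  N = suc n

  residue : ℕ → Fin N
  residue x = fromℕ< (m%n<n x N)

  toℕ-residue : ∀ {x} → x < N → toℕ (residue x) ≡ x
  toℕ-residue {x} x<N = trans (toℕ-fromℕ< (m%n<n x N)) (m<n⇒m%n≡m x<N)

  residue-+N : ∀ x → residue (x + N) ≡ residue x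
  residue-+N x = fromℕ<-cong _ _ ([m+n]%n≡m%n x N) (m%n<n (x + N) N) (m%n<n x N)

  residue-sub : ∀ {x y} → x < N → y < N → residue x -ℤ residue y ≡ residue (x + N ∸ y)
  residue-sub x<N y<N = cong₂ (λ a b → residue (a + N ∸ b)) (toℕ-residue x<N) (toℕ-residue y<N)

  residue-sub-≤ : ∀ {x y d} → y + d ≡ x → x < N → residue x -ℤ residue y ≡ residue d
  residue-sub-≤ {x} {y} {d} y+d≡x x<N = begin
    residue x -ℤ residue y ≡⟨ residue-sub x<N (≤-<-trans (m≤m+n y d) (subst (_< N) (sym y+d≡x) x<N)) ⟩
    residue (x + N ∸ y)    ≡⟨ cong (λ z → residue (z + N ∸ y)) y+d≡x ⟨
    residue (y + d + N ∸ y) ≡⟨ cong residue (trans (cong (_∸ y) (+-assoc y d N)) (m+n∸m≡n y (d + N))) ⟩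
    residue (d + N)        ≡⟨ residue-+N d ⟩
    residue d              ∎
    where open ≡-Reasoning

  residue-sub-> : ∀ {x y d} → y + d ≡ x + N → x < N → y < N → residue x -ℤ residue y ≡ residue d
  residue-sub-> {x} {y} {d} y+d≡x+N x<N y<N = begin
    residue x -ℤ residue y ≡⟨ residue-sub x<N y<N ⟩
    residue (x + N ∸ y)    ≡⟨ cong (λ z → residue (z ∸ y)) y+d≡x+N ⟨
    residue (y + d ∸ y)    ≡⟨ cong residue (m+n∸m≡n y d) ⟩
    residue d              ∎
    where open ≡-Reasoning

  Δ-residues : ∀ (f g : ℕ → ℕ) a b →
    Δ (map residue (applyUpTo f a)) (map residue (applyUpTo g b))
      ≡ concat (applyUpTo (λ i → applyUpTo (λ j → residue (f i) -ℤ residue (g j)) b) a)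
  Δ-residues f g zero    b = refl
  Δ-residues f g (suc a) b = cong₂ _++_
    (trans (sym (map-∘ (applyUpTo g b))) (map-applyUpTo g _ b))
    (Δ-residues (f ∘ suc) g a b)

  length-residues : ∀ (f : ℕ → ℕ) a → length (map residue (applyUpTo f a)) ≡ a
  length-residues f a = trans (length-map residue (applyUpTo f a)) (length-applyUpTo f a)

  ∈-residues⁻ : ∀ {f : ℕ → ℕ} {a x} → (∀ i → i < a → f i < N) →
                x ∈ map residue (applyUpTo f a) → ∃[ i ] i < a × toℕ x ≡ f i
  ∈-residues⁻ {f} f<N x∈ with ∈-map⁻ residue x∈
  ... | _ , y∈ , refl with ∈-applyUpTo⁻ f y∈
  ...   | i , i<a , refl = i , i<a , toℕ-residue (f<N i i<a)

  unique-residues : ∀ {f : ℕ → ℕ} {a} → (∀ {i j} → i < j → j < a → f i < f j) →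
                    (∀ i → i < a → f i < N) → Unique (map residue (applyUpTo f a))
  unique-residues {f} {a} f-mono f<N = subst Unique (sym (map-applyUpTo f residue a))
    (applyUpTo⁺₁ (residue ∘ f) a λ {i} {j} i<j j<a fi≡fj →
      <⇒≢ (f-mono i<j j<a)
        (trans (sym (toℕ-residue (f<N i (<-trans i<j j<a))))
               (trans (cong toℕ fi≡fj) (toℕ-residue (f<N j j<a)))))

<-by-quotient : ∀ {L c c′ a a′} → c < L → a < a′ → c + a * L < c′ + a′ * L
<-by-quotient {L} {c} {c′} {a} {a′} c<L a<a′ = begin-strict
  c + a * L   <⟨ +-monoˡ-< (a * L) c<L ⟩
  suc a * L   ≤⟨ *-monoˡ-≤ L a<a′ ⟩
  a′ * L      ≤⟨ m≤n+m (a′ * L) c′ ⟩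
  c′ + a′ * L ∎
  where open ≤-Reasoning

quotient-unique : ∀ {L c c′ a a′} → c < L → c′ < L → c + a * L ≡ c′ + a′ * L → a ≡ a′
quotient-unique {a = a} {a′} c<L c′<L eq with <-cmp a a′
... | tri< a<a′ _ _ = ⊥-elim (<-irrefl eq (<-by-quotient c<L a<a′))
... | tri≈ _ a≡a′ _ = a≡a′
... | tri> _ _ a′<a = ⊥-elim (<-irrefl (sym eq) (<-by-quotient c′<L a′<a))

∸-∸-≡ : ∀ {x} a b c → a + b + c ≡ x → x ∸ a ∸ b ≡ c
∸-∸-≡ {x} a b c a+b+c≡x =
  trans (∸-+-assoc x a b) (trans (cong (_∸ (a + b)) (sym a+b+c≡x)) (m+n∸m≡n (a + b) c))

module Blocks (l M : ℕ) where

  L : ℕ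
  L = l * l

  open Residues (M * L) public

  interval : ℕ → List (Fin N)
  interval α = map residue (applyUpTo (λ i → i + α * L) l)

  progression : ℕ → List (Fin N)
  progression β = map residue (applyUpTo (λ j → suc j * l + β * L) l)

  run : ℕ → List (Fin N)
  run t = applyUpTo (λ x → residue (suc (x + t * L))) L

  private
    nonZero-l : ∀ {i} → i < l → NonZero l
    nonZero-l i<l = >-nonZero (≤-trans (s≤s z≤n) i<l)

    <l⇒<L : ∀ {i} → i < l → i < L
    <l⇒<L i<l = <-≤-trans i<l (m≤m*n l l ⦃ nonZero-l i<l ⦄)

    *l<L : ∀ {j} → j < l → j * l < L
    *l<L j<l = *-monoˡ-< l ⦃ nonZero-l j<l ⦄ j<l

    <N : ∀ {c β} → c ≤ L → β < M → c + β * L < N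
    <N {c} {β} c≤L β<M = s≤s (begin
      c + β * L ≤⟨ +-monoˡ-≤ (β * L) c≤L ⟩
      suc β * L ≤⟨ *-monoˡ-≤ L β<M ⟩
      M * L     ∎)
      where open ≤-Reasoning

    interval<N : ∀ {i α} → i < l → α < M → i + α * L < N
    interval<N i<l = <N (<⇒≤ (<l⇒<L i<l))

    progression<N : ∀ {j β} → j < l → β < M → suc j * l + β * L < N
    progression<N j<l = <N (*-monoˡ-≤ l j<l)

    progression-minus-interval : ∀ {i α β t} j → i < l → α + t ≡ β →
      i + α * L + suc (l ∸ suc i + j * l + t * L) ≡ suc j * l + β * L
    progression-minus-interval {i} {α} {β} {t} j i<l α+t≡β = begin
      i + α * L + suc (l ∸ suc i + j * l + t * L)
        ≡⟨ regroup i (l ∸ suc i) j α t l L ⟩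
      suc i + (l ∸ suc i) + j * l + (α + t) * L
        ≡⟨ cong₂ (λ a b → a + j * l + b * L) (m+[n∸m]≡n i<l) α+t≡β ⟩
      l + j * l + β * L ∎
      where
      open ≡-Reasoning
      regroup : ∀ i d j α t l L → i + α * L + suc (d + j * l + t * L) ≡ suc i + d + j * l + (α + t) * L
      regroup = solve-∀

    interval-minus-progression : ∀ {j α β t} i → j < l → β + suc t ≡ α + M →
      suc j * l + β * L + suc (i + (l ∸ suc j) * l + t * L) ≡ i + α * L + N
    interval-minus-progression {j} {α} {β} {t} i j<l β+1+t≡α+M = begin
      suc j * l + β * L + suc (i + (l ∸ suc j) * l + t * L)
        ≡⟨ regroup₁ i (l ∸ suc j) j β t l L ⟩
      suc (i + (suc j + (l ∸ suc j)) * l + (β + t) * L)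
        ≡⟨ cong (λ a → suc (i + a * l + (β + t) * L)) (m+[n∸m]≡n j<l) ⟩
      suc (i + L + (β + t) * L)
        ≡⟨ cong suc (regroup₂ i β t L) ⟩
      suc (i + (β + suc t) * L)
        ≡⟨ cong (λ a → suc (i + a * L)) β+1+t≡α+M ⟩
      suc (i + (α + M) * L)
        ≡⟨ regroup₃ i α M L ⟩
      i + α * L + N ∎
      where
      open ≡-Reasoning
      regroup₁ : ∀ i d j β t l L →
        suc j * l + β * L + suc (i + d * l + t * L) ≡ suc (i + (suc j + d) * l + (β + t) * L)
      regroup₁ = solve-∀
      regroup₂ : ∀ i β t L → i + L + (β + t) * L ≡ i + (β + suc t) * L
      regroup₂ = solve-∀
      regroup₃ : ∀ i α M L → suc (i + (α + M) * L) ≡ i + α * L + suc (M * L)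
      regroup₃ = solve-∀

  length-interval : ∀ α → length (interval α) ≡ l
  length-interval α = length-residues (λ i → i + α * L) l

  length-progression : ∀ β → length (progression β) ≡ l
  length-progression β = length-residues (λ j → suc j * l + β * L) l

  unique-interval : ∀ {α} → α < M → Unique (interval α)
  unique-interval {α} α<M = unique-residues (λ i<j _ → +-monoˡ-< (α * L) i<j) (λ i i<l → interval<N i<l α<M)

  unique-progression : ∀ {β} → β < M → Unique (progression β)
  unique-progression {β} β<M = unique-residues
    (λ i<j j<l → +-monoˡ-< (β * L) (*-monoˡ-< l ⦃ nonZero-l j<l ⦄ (s<s i<j)))
    (λ j j<l → progression<N j<l β<M)

  interval-injective : ∀ {α α′ x} → α < M → α′ < M → x ∈ interval α → x ∈ interval α′ → α ≡ α′
  interval-injective α<M α′<M x∈ x∈′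
    with i , i<l , x≡ ← ∈-residues⁻ (λ _ i<l → interval<N i<l α<M) x∈
       | i′ , i′<l , x≡′ ← ∈-residues⁻ (λ _ i<l → interval<N i<l α′<M) x∈′
    = quotient-unique (<l⇒<L i<l) (<l⇒<L i′<l) (trans (sym x≡) x≡′)

  progression-injective : ∀ {β β′ x} → β < M → β′ < M → x ∈ progression β → x ∈ progression β′ → β ≡ β′
  progression-injective {β} {β′} β<M β′<M x∈ x∈′
    with j , j<l , x≡ ← ∈-residues⁻ (λ _ j<l → progression<N j<l β<M) x∈
       | j′ , j′<l , x≡′ ← ∈-residues⁻ (λ _ j<l → progression<N j<l β′<M) x∈′
    = quotient-unique (*l<L j<l) (*l<L j′<l)
        (+-cancelˡ-≡ l _ _ (trans (sym (+-assoc l _ _)) (trans (trans (sym x≡) x≡′) (+-assoc l _ _))))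

  interval-progression-disjoint : ∀ {α β x} → α ≤ β → β < M → x ∈ interval α → ¬ (x ∈ progression β)
  interval-progression-disjoint {α} {β} α≤β β<M x∈ x∈′
    with i , i<l , x≡ ← ∈-residues⁻ (λ _ i<l → interval<N i<l (≤-<-trans α≤β β<M)) x∈
       | j , j<l , x≡′ ← ∈-residues⁻ (λ _ j<l → progression<N j<l β<M) x∈′
    = <-irrefl (trans (sym x≡) x≡′) (begin-strict
        i + α * L           <⟨ +-monoˡ-< (α * L) i<l ⟩
        l + α * L           ≤⟨ +-monoʳ-≤ l (≤-trans (*-monoˡ-≤ L α≤β) (m≤n+m (β * L) (j * l))) ⟩
        l + (j * l + β * L) ≡⟨ +-assoc l (j * l) (β * L) ⟨
        suc j * l + β * L   ∎)
    where open ≤-Reasoning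

  Δ-progression-interval : ∀ {α β t} → α + t ≡ β → β < M → Δ (progression β) (interval α) ↭ run t
  Δ-progression-interval {α} {β} {t} α+t≡β β<M = begin
    Δ (progression β) (interval α)
      ≡⟨ Δ-residues (λ j → suc j * l + β * L) (λ i → i + α * L) l l ⟩
    concat (applyUpTo (λ j → applyUpTo (λ i → residue (suc j * l + β * L) -ℤ residue (i + α * L)) l) l)
      ≡⟨ cong concat (applyUpTo-cong-< l λ j j<l → applyUpTo-cong-< l λ i i<l →
           residue-sub-≤ {y = i + α * L} (progression-minus-interval {α = α} {t = t} j i<l α+t≡β)
                         (progression<N j<l β<M)) ⟩
    concat (applyUpTo (λ j → applyUpTo (λ i → r (l ∸ suc i + j * l)) l) l)
      ↭⟨ concat-applyUpTo⁺ l (λ j _ → applyUpTo-reverse (λ i → r (i + j * l)) l) ⟩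
    concat (applyUpTo (λ j → applyUpTo (λ i → r (i + j * l)) l) l)
      ≡⟨ applyUpTo-* r l l ⟨
    run t ∎
    where
    open PermutationReasoning
    r : ℕ → Fin N
    r x = residue (suc (x + t * L))

  Δ-interval-progression : ∀ {α β t} → β + suc t ≡ α + M → α < M → β < M →
                           Δ (interval α) (progression β) ↭ run t
  Δ-interval-progression {α} {β} {t} β+1+t≡α+M α<M β<M = begin
    Δ (interval α) (progression β)
      ≡⟨ Δ-residues (λ i → i + α * L) (λ j → suc j * l + β * L) l l ⟩
    concat (applyUpTo (λ i → applyUpTo (λ j → residue (i + α * L) -ℤ residue (suc j * l + β * L)) l) l)
      ≡⟨ cong concat (applyUpTo-cong-< l λ i i<l → applyUpTo-cong-< l λ j j<l →
           residue-sub-> (interval-minus-progression {β = β} {t = t} i j<l β+1+t≡α+M)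
                         (interval<N i<l α<M) (progression<N j<l β<M)) ⟩
    concat (applyUpTo (λ i → applyUpTo (λ j → r (i + (l ∸ suc j) * l)) l) l)
      ↭⟨ concat-applyUpTo-transpose (λ i j → r (i + (l ∸ suc j) * l)) l l ⟩
    concat (applyUpTo (λ j → applyUpTo (λ i → r (i + (l ∸ suc j) * l)) l) l)
      ↭⟨ concat⁺ (applyUpTo-reverse (λ j → applyUpTo (λ i → r (i + j * l)) l) l) ⟩
    concat (applyUpTo (λ j → applyUpTo (λ i → r (i + j * l)) l) l)
      ≡⟨ applyUpTo-* r l l ⟨
    run t ∎
    where
    open PermutationReasoning
    r : ℕ → Fin N
    r x = residue (suc (x + t * L))

  runs-nonzero : concat (applyUpTo run M) ≡ nonzeroElems N
  runs-nonzero = begin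
    concat (applyUpTo run M)                       ≡⟨ applyUpTo-* (λ x → residue (suc x)) M L ⟨
    applyUpTo (λ x → residue (suc x)) (M * L)      ≡⟨ map-allFin (M * L) suc-residue ⟨
    map Fin.suc (allFin (M * L))                   ∎
    where
    open ≡-Reasoning
    suc-residue : ∀ (i : Fin (M * L)) → Fin.suc i ≡ residue (suc (toℕ i))
    suc-residue i = toℕ-injective (sym (toℕ-residue (s≤s (toℕ<n i))))

-- I α is the interval of index α; P γ is the progression of index 6k ∸ γ (see ⟦_⟧ in Ladder).
data Block : Set where
  I P : ℕ → Block

index : Block → ℕ
index (I α) = α
index (P γ) = γ

shift : Block → Block
shift (I α) = I (3 + α)
shift (P γ) = P (3 + γ)

Opposite : Block → Block → Set
Opposite (I _) (P _) = ⊤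
Opposite (P _) (I _) = ⊤
Opposite _     _     = ⊥

data Side : Set where
  u v : Side

-- Rung m carries I ⌊3m/2⌋ and P ⌈3m/2⌉, the interval on side v for even m and on side u for odd m.
block : Side → ℕ → Block
block s (suc (suc m)) = shift (block s m)
block u 0 = P 0
block v 0 = I 0
block u 1 = I 1
block v 1 = P 2

-- I 2 and P 1 are assigned to no vertex, so their owner is arbitrary.
owner : Block → Side × ℕ
owner (I 0) = v , 0
owner (I 1) = u , 1
owner (I 2) = u , 0
owner (I (suc (suc (suc α)))) = map₂ (2 +_) (owner (I α))
owner (P 0) = u , 0
owner (P 1) = u , 0
owner (P 2) = v , 1
owner (P (suc (suc (suc γ)))) = map₂ (2 +_) (owner (P γ))

owner-block : ∀ s m → owner (block s m) ≡ (s , m)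
owner-block u 0 = refl
owner-block v 0 = refl
owner-block u 1 = refl
owner-block v 1 = refl
owner-block s (suc (suc m)) = trans (owner-shift (block s m)) (cong (map₂ (2 +_)) (owner-block s m))
  where
  owner-shift : ∀ b → owner (shift b) ≡ map₂ (2 +_) (owner b)
  owner-shift (I _) = refl
  owner-shift (P _) = refl

block-≤ : ∀ s k {m} → m ≤ k * 2 → index (block s m) ≤ k * 3
block-≤ u k       {0}           _              = z≤n
block-≤ v k       {0}           _              = z≤n
block-≤ u (suc k) {1}           _              = s≤s z≤n
block-≤ v (suc k) {1}           _              = s≤s (s≤s z≤n)
block-≤ s (suc k) {suc (suc m)} (s≤s (s≤s m≤)) = index-shift (block s m) (block-≤ s k m≤)
  where
  index-shift : ∀ b → index b ≤ k * 3 → index (shift b) ≤ suc k * 3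
  index-shift (I _) = +-monoʳ-≤ 3
  index-shift (P _) = +-monoʳ-≤ 3

opposite-shift : ∀ b b′ → Opposite b b′ → Opposite (shift b) (shift b′)
opposite-shift (I _) (P _) _ = tt
opposite-shift (P _) (I _) _ = tt

rail-opposite : ∀ s m → Opposite (block s (suc m)) (block s m)
rail-opposite u 0 = tt
rail-opposite v 0 = tt
rail-opposite u 1 = tt
rail-opposite v 1 = tt
rail-opposite s (suc (suc m)) = opposite-shift (block s (suc m)) (block s m) (rail-opposite s m)

rung-opposite : ∀ m → Opposite (block u m) (block v m)
rung-opposite 0 = tt
rung-opposite 1 = tt
rung-opposite (suc (suc m)) = opposite-shift (block u m) (block v m) (rung-opposite m)

block-u-even : ∀ j → block u (j * 2) ≡ P (j * 3)
block-u-even zero    = refl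
block-u-even (suc j) = cong shift (block-u-even j)

block-u-odd : ∀ j → block u (suc (j * 2)) ≡ I (suc (j * 3))
block-u-odd zero    = refl
block-u-odd (suc j) = cong shift (block-u-odd j)

block-v-even : ∀ j → block v (j * 2) ≡ I (j * 3)
block-v-even zero    = refl
block-v-even (suc j) = cong shift (block-v-even j)

block-v-odd : ∀ j → block v (suc (j * 2)) ≡ P (2 + j * 3)
block-v-odd zero    = refl
block-v-odd (suc j) = cong shift (block-v-odd j)

module Gaps (k : ℕ) where

  n : ℕ
  n = 2 * k + 1

  n≡ : n ≡ suc (k * 2)
  n≡ = trans (+-comm (2 * k) 1) (cong suc (*-comm 2 k))

  ≤⇒<n : ∀ {m} → m ≤ k * 2 → m < n
  ≤⇒<n {m} m≤ = subst (m <_) (sym n≡) (s≤s m≤)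

  <n⇒≤ : ∀ {m} → m < n → m ≤ k * 2
  <n⇒≤ {m} m<n = ≤-pred (subst (m <_) n≡ m<n)

  6k≡ : k * 3 + k * 3 ≡ 6 * k
  6k≡ = lemma k
    where
    lemma : ∀ k → k * 3 + k * 3 ≡ 6 * k
    lemma = solve-∀

  gap : Block → Block → ℕ
  gap (I α) (P γ) = α + γ
  gap (P γ) (I α) = 6 * k ∸ γ ∸ α
  gap _     _     = 0   -- junk: every arc of the ladder joins an interval and a progression

  railGaps : ℕ → List ℕ
  railGaps m with suc m <? n
  ... | yes _ = gap (block u (suc m)) (block u m) ∷ gap (block v (suc m)) (block v m) ∷ []
  ... | no _  = []

  rungGap : ℕ → ℕ
  rungGap m = gap (block u m) (block v m)

  arcGaps : List ℕ
  arcGaps = concat (applyUpTo railGaps n) ++ applyUpTo rungGap n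

  rowGaps : ℕ → List ℕ
  rowGaps j = (railGaps (j * 2) ++ railGaps (suc (j * 2))) ++ rungGap (j * 2) ∷ rungGap (suc (j * 2)) ∷ []

  oddRow : ℕ → List ℕ
  oddRow j = 1 + j * 6 ∷ 3 + j * 6 ∷ 5 + j * 6 ∷ []

  evenRow : ℕ → List ℕ
  evenRow s = 2 + s * 6 ∷ 4 + s * 6 ∷ 6 + s * 6 ∷ []

  rowGaps-↭ : ∀ {j} → j < k → rowGaps j ↭ oddRow j ++ evenRow (k ∸ suc j)
  rowGaps-↭ {j} j<k
    rewrite dec-yes-irr (suc (j * 2) <? n) <-irrelevant (≤⇒<n (<⇒≤ (*-monoˡ-≤ 2 j<k)))
          | dec-yes-irr (suc (suc (j * 2)) <? n) <-irrelevant (≤⇒<n (*-monoˡ-≤ 2 j<k))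
          | block-u-even j | block-u-odd j | block-v-even j | block-v-odd j
    = ↭-trans (↭-reflexive (Pointwise-≡⇒≡ (o₁ j ∷ from-6k (2 + j * 3) (j * 3) (e₂ j s)
                                             ∷ from-6k (3 + j * 3) (suc (j * 3)) (e₁ j s) ∷ o₃ j
                                             ∷ from-6k (j * 3) (j * 3) (e₃ j s) ∷ o₂ j ∷ [])))
              (shuffle _ _ _ _ _ _)
    where
    s : ℕ
    s = k ∸ suc j
    from-6k : ∀ a b {c} → a + b + c ≡ 6 * (j + suc s) → 6 * k ∸ a ∸ b ≡ c
    from-6k a b {c} eq = ∸-∸-≡ a b c (trans eq (cong (6 *_) (trans (+-suc j s) (m+[n∸m]≡n j<k))))
    o₁ : ∀ j → suc (j * 3) + j * 3 ≡ 1 + j * 6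
    o₁ = solve-∀
    o₂ : ∀ j → suc (j * 3) + (2 + j * 3) ≡ 3 + j * 6
    o₂ = solve-∀
    o₃ : ∀ j → 3 + j * 3 + (2 + j * 3) ≡ 5 + j * 6
    o₃ = solve-∀
    e₁ : ∀ j s → 3 + j * 3 + suc (j * 3) + (2 + s * 6) ≡ 6 * (j + suc s)
    e₁ = solve-∀
    e₂ : ∀ j s → 2 + j * 3 + j * 3 + (4 + s * 6) ≡ 6 * (j + suc s)
    e₂ = solve-∀
    e₃ : ∀ j s → j * 3 + j * 3 + (6 + s * 6) ≡ 6 * (j + suc s)
    e₃ = solve-∀
    shuffle : ∀ (a b c d e f : ℕ) → a ∷ e ∷ d ∷ c ∷ f ∷ b ∷ [] ↭ a ∷ b ∷ c ∷ d ∷ e ∷ f ∷ []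
    shuffle a b c d e f = ↭-prep a (↭-trans (↭-shift b (e ∷ d ∷ c ∷ f ∷ []) [])
                            (↭-prep b (↭-trans (↭-shift c (e ∷ d ∷ []) (f ∷ [])) (↭-prep c (↭-swap e d ↭-refl)))))

  railGaps-last : railGaps (k * 2) ≡ []
  railGaps-last rewrite dec-no (suc (k * 2) <? n) (λ h → <-irrefl refl (<n⇒≤ h)) = refl

  rungGap-last : rungGap (k * 2) ≡ 0
  rungGap-last rewrite block-u-even k | block-v-even k = ∸-∸-≡ (k * 3) (k * 3) 0 (trans (+-identityʳ _) 6k≡)

  arcGaps-↭-rows : arcGaps ↭ 0 ∷ concat (applyUpTo rowGaps k)
  arcGaps-↭-rows = begin
    concat (applyUpTo railGaps n) ++ applyUpTo rungGap n
      ≡⟨ cong₂ _++_ (cong (concat ∘ applyUpTo railGaps) n≡) (cong (applyUpTo rungGap) n≡) ⟩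
    concat (applyUpTo railGaps (suc (k * 2))) ++ applyUpTo rungGap (suc (k * 2))
      ≡⟨ cong₂ _++_ (concat-applyUpTo-pairs railGaps k)
                    (trans (sym (concat-applyUpTo-[-] rungGap (suc (k * 2))))
                           (concat-applyUpTo-pairs ([_] ∘ rungGap) k)) ⟩
    (rails ++ railGaps (k * 2)) ++ (rungs ++ [ rungGap (k * 2) ])
      ≡⟨ cong₂ (λ xs x → (rails ++ xs) ++ (rungs ++ [ x ])) railGaps-last rungGap-last ⟩
    (rails ++ []) ++ (rungs ++ [ 0 ])
      ≡⟨ trans (cong (_++ (rungs ++ [ 0 ])) (++-identityʳ rails)) (sym (++-assoc rails rungs [ 0 ])) ⟩
    (rails ++ rungs) ∷ʳ 0
      ↭⟨ ∷↭∷ʳ 0 (rails ++ rungs) ⟨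
    0 ∷ (rails ++ rungs)
      ↭⟨ ↭-prep 0 (concat-applyUpTo-++ _ _ k) ⟨
    0 ∷ concat (applyUpTo rowGaps k) ∎
    where
    open PermutationReasoning
    rails rungs : List ℕ
    rails = concat (applyUpTo (λ j → railGaps (j * 2) ++ railGaps (suc (j * 2))) k)
    rungs = concat (applyUpTo (λ j → [ rungGap (j * 2) ] ++ [ rungGap (suc (j * 2)) ]) k)

  rows-↭ : concat (applyUpTo rowGaps k) ↭ applyUpTo suc (k * 6)
  rows-↭ = begin
    concat (applyUpTo rowGaps k)
      ↭⟨ concat-applyUpTo⁺ k (λ _ → rowGaps-↭) ⟩
    concat (applyUpTo (λ j → oddRow j ++ evenRow (k ∸ suc j)) k)
      ↭⟨ concat-applyUpTo-++ oddRow (λ j → evenRow (k ∸ suc j)) k ⟩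
    concat (applyUpTo oddRow k) ++ concat (applyUpTo (λ j → evenRow (k ∸ suc j)) k)
      ↭⟨ ++⁺ˡ (concat (applyUpTo oddRow k)) (concat⁺ (applyUpTo-reverse evenRow k)) ⟩
    concat (applyUpTo oddRow k) ++ concat (applyUpTo evenRow k)
      ↭⟨ concat-applyUpTo-++ oddRow evenRow k ⟨
    concat (applyUpTo (λ j → oddRow j ++ evenRow j) k)
      ↭⟨ concat-applyUpTo⁺ k (λ j _ → interleave _ _ _ _ _ _) ⟩
    concat (applyUpTo (λ j → applyUpTo (λ c → suc (c + j * 6)) 6) k)
      ≡⟨ applyUpTo-* suc k 6 ⟨
    applyUpTo suc (k * 6) ∎
    where
    open PermutationReasoning
    interleave : ∀ (a b c d e f : ℕ) → a ∷ c ∷ e ∷ b ∷ d ∷ f ∷ [] ↭ a ∷ b ∷ c ∷ d ∷ e ∷ f ∷ []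
    interleave a b c d e f =
      ↭-prep a (↭-trans (↭-shift b (c ∷ e ∷ []) (d ∷ f ∷ [])) (↭-prep b (↭-prep c (↭-swap e d ↭-refl))))

  arcGaps-↭-upTo : arcGaps ↭ upTo (6 * k + 1)
  arcGaps-↭-upTo = begin
    arcGaps                        ↭⟨ arcGaps-↭-rows ⟩
    0 ∷ concat (applyUpTo rowGaps k) ↭⟨ ↭-prep 0 rows-↭ ⟩
    upTo (suc (k * 6))             ≡⟨ cong upTo (trans (cong suc (*-comm k 6)) (+-comm 1 (6 * k))) ⟩
    upTo (6 * k + 1)               ∎
    where open PermutationReasoning

-- ladderArcs builds its rails with a local function; unification gives it a name here.
mutual
  railArcs : (n : ℕ) → Fin n → List (Fin (n + n) × Fin (n + n))
  railArcs = _

  ladderArcs-rails-rungs : ∀ n →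
    ladderArcs n ≡ concatMap (railArcs n) (allFin n) ++ map (λ i → n ↑ʳ i , i ↑ˡ n) (allFin n)
  ladderArcs-rails-rungs n = refl

module Ladder (k l : ℕ) where

  open Gaps k
  open Blocks l (6 * k + 1)

  ⟦_⟧ : Block → List (Fin N)
  ⟦ I α ⟧ = interval α
  ⟦ P γ ⟧ = progression (6 * k ∸ γ)

  sideRung : Fin n ⊎ Fin n → Side × ℕ
  sideRung = [ (λ i → u , toℕ i) , (λ i → v , toℕ i) ]′

  sideRung-injective : ∀ x y → sideRung x ≡ sideRung y → x ≡ y
  sideRung-injective (inj₁ i) (inj₁ j) eq = cong inj₁ (toℕ-injective (cong proj₂ eq))
  sideRung-injective (inj₂ i) (inj₂ j) eq = cong inj₂ (toℕ-injective (cong proj₂ eq))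
  sideRung-injective (inj₁ _) (inj₂ _) ()
  sideRung-injective (inj₂ _) (inj₁ _) ()

  position : Fin (n + n) → Side × ℕ
  position w = sideRung (splitAt n w)

  blockAt : Fin (n + n) → Block
  blockAt w = uncurry block (position w)

  A : Fin (n + n) → List (Fin N)
  A w = ⟦ blockAt w ⟧

  A-u : ∀ i → A (i ↑ˡ n) ≡ ⟦ block u (toℕ i) ⟧
  A-u i = cong (λ x → ⟦ uncurry block (sideRung x) ⟧) (splitAt-↑ˡ n i n)

  A-v : ∀ i → A (n ↑ʳ i) ≡ ⟦ block v (toℕ i) ⟧
  A-v i = cong (λ x → ⟦ uncurry block (sideRung x) ⟧) (splitAt-↑ʳ n n i)

  position-injective : ∀ {w w′} → position w ≡ position w′ → w ≡ w′
  position-injective {w} {w′} eq = begin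
    w                       ≡⟨ join-splitAt n n w ⟨
    join n n (splitAt n w)  ≡⟨ cong (join n n) (sideRung-injective (splitAt n w) (splitAt n w′) eq) ⟩
    join n n (splitAt n w′) ≡⟨ join-splitAt n n w′ ⟩
    w′                      ∎
    where open ≡-Reasoning

  blockAt-≤ : ∀ w → index (blockAt w) ≤ k * 3
  blockAt-≤ w with splitAt n w
  ... | inj₁ i = block-≤ u k (<n⇒≤ (toℕ<n i))
  ... | inj₂ i = block-≤ v k (<n⇒≤ (toℕ<n i))

  private
    +≤6k : ∀ {α γ} → α ≤ k * 3 → γ ≤ k * 3 → α + γ ≤ 6 * k
    +≤6k α≤ γ≤ = ≤-trans (+-mono-≤ α≤ γ≤) (≤-reflexive 6k≡)

    ≤6k⇒<M : ∀ {x} → x ≤ 6 * k → x < 6 * k + 1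
    ≤6k⇒<M {x} x≤ = subst (x <_) (+-comm 1 (6 * k)) (s≤s x≤)

    ≤k*3⇒≤6k : ∀ {x} → x ≤ k * 3 → x ≤ 6 * k
    ≤k*3⇒≤6k x≤ = ≤-trans x≤ (≤-trans (m≤m+n (k * 3) (k * 3)) (≤-reflexive 6k≡))

    ≤k*3⇒<M : ∀ {x} → x ≤ k * 3 → x < 6 * k + 1
    ≤k*3⇒<M x≤ = ≤6k⇒<M (≤k*3⇒≤6k x≤)

    6k∸<M : ∀ γ → 6 * k ∸ γ < 6 * k + 1
    6k∸<M γ = ≤6k⇒<M (m∸n≤m (6 * k) γ)

  length-⟦⟧ : ∀ b → length ⟦ b ⟧ ≡ l
  length-⟦⟧ (I α) = length-interval α
  length-⟦⟧ (P γ) = length-progression (6 * k ∸ γ)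

  unique-⟦⟧ : ∀ b → index b ≤ k * 3 → Unique ⟦ b ⟧
  unique-⟦⟧ (I α) α≤ = unique-interval (≤k*3⇒<M α≤)
  unique-⟦⟧ (P γ) _  = unique-progression (6k∸<M γ)

  ⟦⟧-injective : ∀ b b′ {x} → index b ≤ k * 3 → index b′ ≤ k * 3 →
                 x ∈ ⟦ b ⟧ → x ∈ ⟦ b′ ⟧ → b ≡ b′
  ⟦⟧-injective (I α) (I α′) α≤ α′≤ x∈ x∈′ =
    cong I (interval-injective (≤k*3⇒<M α≤) (≤k*3⇒<M α′≤) x∈ x∈′)
  ⟦⟧-injective (P γ) (P γ′) γ≤ γ′≤ x∈ x∈′ =
    cong P (∸-cancelˡ-≡ (≤k*3⇒≤6k γ≤) (≤k*3⇒≤6k γ′≤)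
      (progression-injective (6k∸<M γ) (6k∸<M γ′) x∈ x∈′))
  ⟦⟧-injective (I α) (P γ) α≤ γ≤ x∈ x∈′ =
    ⊥-elim (interval-progression-disjoint (m+n≤o⇒m≤o∸n α (+≤6k α≤ γ≤)) (6k∸<M γ) x∈ x∈′)
  ⟦⟧-injective (P γ) (I α) γ≤ α≤ x∈ x∈′ =
    ⊥-elim (interval-progression-disjoint (m+n≤o⇒m≤o∸n α (+≤6k α≤ γ≤)) (6k∸<M γ) x∈′ x∈)

  Δ-⟦⟧ : ∀ b′ b → Opposite b′ b → index b′ ≤ k * 3 → index b ≤ k * 3 →
         Δ ⟦ b′ ⟧ ⟦ b ⟧ ↭ run (gap b′ b)
  Δ-⟦⟧ (I α) (P γ) _ α≤ γ≤ =
    Δ-interval-progression wrap (≤k*3⇒<M α≤) (6k∸<M γ)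
    where
    regroup : ∀ d α γ → d + suc (α + γ) ≡ α + (d + γ + 1)
    regroup = solve-∀
    wrap : 6 * k ∸ γ + suc (α + γ) ≡ α + (6 * k + 1)
    wrap = trans (regroup (6 * k ∸ γ) α γ) (cong (λ x → α + (x + 1)) (m∸n+n≡m (≤k*3⇒≤6k γ≤)))
  Δ-⟦⟧ (P γ) (I α) _ γ≤ α≤ =
    Δ-progression-interval {α = α} (m+[n∸m]≡n (m+n≤o⇒m≤o∸n α (+≤6k α≤ γ≤))) (6k∸<M γ)

  arcDiffs : Fin (n + n) × Fin (n + n) → List (Fin N)
  arcDiffs e = Δ (A (proj₂ e)) (A (proj₁ e))

  rail-diffs : ∀ i → concatMap arcDiffs (railArcs n i) ↭ concatMap run (railGaps (toℕ i))
  rail-diffs i with suc (toℕ i) <? n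
  ... | no _  = ↭-refl
  ... | yes p rewrite A-u i | A-v i | A-u (fromℕ< p) | A-v (fromℕ< p) | toℕ-fromℕ< p =
    ++⁺ (rail u) (++⁺ (rail v) ↭-refl)
    where
    m : ℕ
    m = toℕ i
    rail : ∀ s → Δ ⟦ block s (suc m) ⟧ ⟦ block s m ⟧ ↭ run (gap (block s (suc m)) (block s m))
    rail s = Δ-⟦⟧ _ _ (rail-opposite s m) (block-≤ s k (<n⇒≤ p)) (block-≤ s k (<n⇒≤ (<-trans (n<1+n m) p)))

  rung-diffs : ∀ i → arcDiffs (n ↑ʳ i , i ↑ˡ n) ↭ run (rungGap (toℕ i))
  rung-diffs i rewrite A-u i | A-v i =
    Δ-⟦⟧ _ _ (rung-opposite (toℕ i)) (block-≤ u k (<n⇒≤ (toℕ<n i))) (block-≤ v k (<n⇒≤ (toℕ<n i)))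

  ladder-diffs : concatMap arcDiffs (ladderArcs n) ↭ concatMap run arcGaps
  ladder-diffs = begin
    concatMap arcDiffs (concatMap (railArcs n) (allFin n) ++ map rung (allFin n))
      ≡⟨ distribute arcDiffs (railArcs n) rung ⟩
    concatMap (concatMap arcDiffs ∘ railArcs n) (allFin n) ++ concatMap (arcDiffs ∘ rung) (allFin n)
      ↭⟨ ++⁺ (concatMap⁺ (allFin n) rail-diffs) (concatMap⁺ (allFin n) rung-diffs) ⟩
    concatMap (concatMap run ∘ railGaps ∘ toℕ) (allFin n) ++ concatMap (run ∘ rungGap ∘ toℕ) (allFin n)
      ≡⟨ distribute run (railGaps ∘ toℕ) (rungGap ∘ toℕ) ⟨
    concatMap run (concatMap (railGaps ∘ toℕ) (allFin n) ++ map (rungGap ∘ toℕ) (allFin n))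
      ≡⟨ cong (concatMap run)
              (cong₂ _++_ (cong concat (map-allFin n (λ _ → refl))) (map-allFin n (λ _ → refl))) ⟩
    concatMap run arcGaps ∎
    where
    open PermutationReasoning
    rung : Fin n → Fin (n + n) × Fin (n + n)
    rung i = n ↑ʳ i , i ↑ˡ n
    distribute : ∀ {B C : Set} (f : B → List C) (g : Fin n → List B) (h : Fin n → B) →
      concatMap f (concatMap g (allFin n) ++ map h (allFin n))
        ≡ concatMap (concatMap f ∘ g) (allFin n) ++ concatMap (f ∘ h) (allFin n)
    distribute f g h = trans (concatMap-++ f (concatMap g (allFin n)) (map h (allFin n)))
                             (cong₂ _++_ (sym (associative (allFin n) g f)) (concatMap-map f h (allFin n)))

  differences : concatMap arcDiffs (ladderArcs n) ↭ replicateL 1 (nonzeroElems N)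
  differences = begin
    concatMap arcDiffs (ladderArcs n) ↭⟨ ladder-diffs ⟩
    concatMap run arcGaps             ↭⟨ concat⁺ (map⁺ run arcGaps-↭-upTo) ⟩
    concatMap run (upTo (6 * k + 1))  ≡⟨ cong concat (map-upTo run (6 * k + 1)) ⟩
    concat (applyUpTo run (6 * k + 1)) ≡⟨ runs-nonzero ⟩
    nonzeroElems N                    ≡⟨ ++-identityʳ (nonzeroElems N) ⟨
    replicateL 1 (nonzeroElems N)     ∎
    where open PermutationReasoning

  disjoint : ∀ w w′ → ¬ (w ≡ w′) → ∀ x → x ∈ A w → ¬ (x ∈ A w′)
  disjoint w w′ w≢w′ x x∈ x∈′ = w≢w′ (position-injective (begin
    position w          ≡⟨ owner-block (proj₁ (position w)) (proj₂ (position w)) ⟨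
    owner (blockAt w)
      ≡⟨ cong owner (⟦⟧-injective (blockAt w) (blockAt w′) (blockAt-≤ w) (blockAt-≤ w′) x∈ x∈′) ⟩
    owner (blockAt w′)  ≡⟨ owner-block (proj₁ (position w′)) (proj₂ (position w′)) ⟩
    position w′         ∎))
    where open ≡-Reasoning

  isEDF : IsEDF N (n + n) l 1 (L* n) A
  isEDF = record
    { size        = λ w → length-⟦⟧ (blockAt w)
    ; isSet       = λ w → unique-⟦⟧ (blockAt w) (blockAt-≤ w)
    ; disjoint    = disjoint
    ; differences = differences
    }

theorem6p9 : (k l : ℕ) → k ≥ 1 → l ≥ 1 →
    Σ (Fin (2 * k + 1 + (2 * k + 1)) → List (Fin (suc ((6 * k + 1) * (l * l)))))
      (λ A → IsEDF (suc ((6 * k + 1) * (l * l))) (2 * k + 1 + (2 * k + 1)) l 1 (L* (2 * k + 1)) A)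
theorem6p9 k l _ _ = A , isEDF
  where open Ladder k l
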